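{- For every $n\ge1$, there are exactly $n$ unimodal involutions in $\mathcal{S}_n$. Consequently $\sum_{n\ge1}|\mathcal{I}^{(n)}|x^n=\dfrac{x}{(1-x)^2}$.
   Context: $\mathcal{S}_n$ is the set of permutations of $[n]$, in one-line notation $\pi_1\cdots\pi_n$. A permutation is unimodal if its one-line notation is strictly increasing and then strictly decreasing. An involution is a permutation equal to its own inverse. $\mathcal{I}^{(n)}$ denotes the set of unimodal involutions in $\mathcal{S}_n$. -}

module Defs where

open import Data.Nat using (ℕ)
open import Data.Fin using (Fin; _<_; _≤_)
open import Data.Vec using (Vec; lookup)
open import Data.Product using (Σ; _×_; ∃; proj₁)
open import Relation.Binary.PropositionalEquality using (_≡_)

-- One-line notation: π = π₁ ⋯ πₙ as a vector of length n over Fin n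
-- (positions/values 0..n-1 stand for 1..n).
-- A permutation of [n]: the one-line word is injective (hence bijective).
IsPerm : ∀ {n} → Vec (Fin n) n → Set
IsPerm {n} π = ∀ (i j : Fin n) → lookup π i ≡ lookup π j → i ≡ j

IsInvolution : ∀ {n} → Vec (Fin n) n → Set
IsInvolution {n} π = ∀ (i : Fin n) → lookup π (lookup π i) ≡ i

IsUnimodal : ∀ {n} → Vec (Fin n) n → Set
IsUnimodal {n} π = ∃ λ (m : Fin n) →
  (∀ (i j : Fin n) → i < j → j ≤ m → lookup π i < lookup π j) ×
  (∀ (i j : Fin n) → m ≤ i → i < j → lookup π j < lookup π i)

UnimodalInvolution : ℕ → Set
UnimodalInvolution n =
  Σ (Vec (Fin n) n) λ π → IsPerm π × IsInvolution π × IsUnimodal π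

-- |𝓘⁽ⁿ⁾| = k : a bijection 𝓘⁽ⁿ⁾ → Fin k (elements of the subtype are equal
-- iff their one-line words are equal).
CardinalityIs : ℕ → ℕ → Set
CardinalityIs n k =
  Σ (UnimodalInvolution n → Fin k) λ f →
    (∀ (x y : UnimodalInvolution n) → f x ≡ f y → proj₁ x ≡ proj₁ y) ×
    (∀ (c : Fin k) → ∃ λ (x : UnimodalInvolution n) → f x ≡ c)

module Submission where

open import Defs
open import Data.Nat using (ℕ; zero; suc; _+_; _∸_; _≤_; _<_; _≥_; _<?_; _≤?_; s≤s)
open import Data.Nat.Properties
open import Data.Fin using (Fin; toℕ; fromℕ; fromℕ<)
open import Data.Fin.Properties using (toℕ-injective; toℕ<n; toℕ≤pred[n]; toℕ-fromℕ; toℕ-fromℕ<; fromℕ<-toℕ)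
open import Data.Vec using (Vec; lookup; tabulate)
open import Data.Vec.Properties using (lookup∘tabulate; tabulate∘lookup; tabulate-cong)
open import Data.Product using (proj₁; proj₂; _,_)
open import Data.Empty using (⊥-elim)
open import Relation.Nullary using (yes; no)
open import Relation.Binary using (tri<; tri≈; tri>)
open import Relation.Binary.PropositionalEquality

-- With positions and values 0, …, N, a unimodal involution with last letter c
-- is forced to be the word 0 1 ⋯ (c−1) N (N−1) ⋯ c.  Since π(c) = π(π(N)) = N
-- is the maximal value, the peak sits at position c.
-- Below c, an increasing involution must fix every point.  From position c to
-- position N the word strictly decreases from N to c, i.e. through N − c + 1
-- distinct values in an interval of exactly that size, so it is the reversal.
-- Hence the last letter is a bijection onto {0, …, N}.

m≤m+n∸o : ∀ m {n o} → o ≤ n → m ≤ m + n ∸ o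
m≤m+n∸o m {n} {o} o≤n = subst (m ≤_) (sym (+-∸-assoc m o≤n)) (m≤m+n m (n ∸ o))

StrictlyDecreasingOn : ℕ → ℕ → (ℕ → ℕ) → Set
StrictlyDecreasingOn a b q = ∀ k l → a ≤ k → k < l → l ≤ b → q l < q k

decreasing-gap : ∀ {a b q} → StrictlyDecreasingOn a b q →
                 ∀ k d → a ≤ k → k + d ≤ b → q (k + d) + d ≤ q k
decreasing-gap {q = q} _ k zero _ _ = ≤-reflexive (trans (+-identityʳ _) (cong q (+-identityʳ k)))
decreasing-gap {q = q} dec k (suc d) a≤k k+1+d≤b = begin
  q (k + suc d) + suc d   ≡⟨ +-suc (q (k + suc d)) d ⟩
  suc (q (k + suc d)) + d ≤⟨ +-monoˡ-≤ d step ⟩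
  q (k + d) + d           ≤⟨ decreasing-gap dec k d a≤k (≤-trans (+-monoʳ-≤ k (n≤1+n d)) k+1+d≤b) ⟩
  q k                     ∎
  where
  open ≤-Reasoning
  step : q (k + suc d) < q (k + d)
  step = dec (k + d) (k + suc d) (≤-trans a≤k (m≤m+n k d)) (+-monoʳ-< k (n<1+n d)) k+1+d≤b

decreasing-squeeze : ∀ {c N q} → StrictlyDecreasingOn c N q → q c ≤ N → c ≤ q N →
                     ∀ {k} → c ≤ k → k ≤ N → q k ≡ c + N ∸ k
decreasing-squeeze {c} {N} {q} dec qc≤N c≤qN {k} c≤k k≤N = ≤-antisym upper lower
  where
  open ≤-Reasoning
  d = k ∸ c
  e = N ∸ k
  c+d≡k : c + d ≡ k
  c+d≡k = m+[n∸m]≡n c≤k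
  k+e≡N : k + e ≡ N
  k+e≡N = m+[n∸m]≡n k≤N
  lower : c + N ∸ k ≤ q k
  lower = begin
    c + N ∸ k     ≡⟨ +-∸-assoc c k≤N ⟩
    c + e         ≤⟨ +-monoˡ-≤ e c≤qN ⟩
    q N + e       ≡⟨ cong (λ l → q l + e) (sym k+e≡N) ⟩
    q (k + e) + e ≤⟨ decreasing-gap dec k e c≤k (≤-reflexive k+e≡N) ⟩
    q k           ∎
  upper : q k ≤ c + N ∸ k
  upper = begin
    q k             ≡⟨ cong q (sym c+d≡k) ⟩
    q (c + d)       ≤⟨ m+n≤o⇒m≤o∸n (q (c + d)) (≤-trans gap qc≤N) ⟩
    N ∸ d           ≡⟨ sym ([m+n]∸[m+o]≡n∸o c N d) ⟩
    c + N ∸ (c + d) ≡⟨ cong (c + N ∸_) c+d≡k ⟩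
    c + N ∸ k       ∎
    where
    gap : q (c + d) + d ≤ q c
    gap = decreasing-gap dec c d ≤-refl (subst (_≤ N) (sym c+d≡k) k≤N)

extendℕ : ∀ {n} → (Fin n → ℕ) → ℕ → ℕ
extendℕ {n} f k with k <? n
... | yes k<n = f (fromℕ< k<n)
... | no  _   = 0

extendℕ-toℕ : ∀ {n} (f : Fin n → ℕ) i → extendℕ f (toℕ i) ≡ f i
extendℕ-toℕ {n} f i with toℕ i <? n
... | yes i<n = cong f (fromℕ<-toℕ i i<n)
... | no  i≮n = ⊥-elim (i≮n (toℕ<n i))

extendℕ-fromℕ< : ∀ {n} (f : Fin n → ℕ) {k} (k<n : k < n) → extendℕ f k ≡ f (fromℕ< k<n)
extendℕ-fromℕ< f k<n = trans (cong (extendℕ f) (sym (toℕ-fromℕ< k<n))) (extendℕ-toℕ f (fromℕ< k<n))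

involution⇒perm : ∀ {n} (π : Vec (Fin n) n) → IsInvolution π → IsPerm π
involution⇒perm π inv i j πi≡πj = trans (sym (inv i)) (trans (cong (lookup π) πi≡πj) (inv j))

peak-isMaximum : ∀ {n} (π : Vec (Fin n) n) ((m , _) : IsUnimodal π) →
                 ∀ i → toℕ (lookup π i) ≤ toℕ (lookup π m)
peak-isMaximum π (m , increasing , decreasing) i with <-cmp (toℕ i) (toℕ m)
... | tri< i<m _ _ = <⇒≤ (increasing i m i<m ≤-refl)
... | tri≈ _ i≡m _ = ≤-reflexive (cong (λ k → toℕ (lookup π k)) (toℕ-injective i≡m))
... | tri> _ _ m<i = <⇒≤ (decreasing m i ≤-refl m<i)

reverseFrom : ℕ → ℕ → ℕ → ℕ
reverseFrom N c i with i <? c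
... | yes _ = i
... | no  _ = c + N ∸ i

reverseFrom-< : ∀ N {c i} → i < c → reverseFrom N c i ≡ i
reverseFrom-< N {c} {i} i<c with i <? c
... | yes _   = refl
... | no  i≮c = ⊥-elim (i≮c i<c)

reverseFrom-≥ : ∀ N {c i} → c ≤ i → reverseFrom N c i ≡ c + N ∸ i
reverseFrom-≥ N {c} {i} c≤i with i <? c
... | yes i<c = ⊥-elim (<⇒≱ i<c c≤i)
... | no  _   = refl

reverseFrom-≤ : ∀ {N c i} → i ≤ N → reverseFrom N c i ≤ N
reverseFrom-≤ {N} {c} {i} i≤N with i <? c
... | yes _   = i≤N
... | no  i≮c = subst (c + N ∸ i ≤_) (m+n∸m≡n c N) (∸-monoʳ-≤ (c + N) (≮⇒≥ i≮c))

reverseFrom-involutive : ∀ {N} c {i} → i ≤ N → reverseFrom N c (reverseFrom N c i) ≡ i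
reverseFrom-involutive {N} c {i} i≤N with i <? c
... | yes i<c = reverseFrom-< N i<c
... | no  _   = begin
  reverseFrom N c (c + N ∸ i) ≡⟨ reverseFrom-≥ N (m≤m+n∸o c i≤N) ⟩
  c + N ∸ (c + N ∸ i)         ≡⟨ m∸[m∸n]≡n (m≤n⇒m≤o+n c i≤N) ⟩
  i                           ∎
  where open ≡-Reasoning

reverseFrom-increasing : ∀ {N c i j} → i < j → j ≤ c → c ≤ N → reverseFrom N c i < reverseFrom N c j
reverseFrom-increasing {N} {c} {i} {j} i<j j≤c c≤N
  rewrite reverseFrom-< N (<-≤-trans i<j j≤c) with j <? c
... | yes _ = i<j
... | no  _ = <-≤-trans i<j (≤-trans j≤c (m≤m+n∸o c (≤-trans j≤c c≤N)))

reverseFrom-decreasing : ∀ {N c i j} → c ≤ i → i < j → j ≤ N → reverseFrom N c j < reverseFrom N c i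
reverseFrom-decreasing {N} {c} {i} {j} c≤i i<j j≤N
  rewrite reverseFrom-≥ N c≤i | reverseFrom-≥ N (≤-trans c≤i (<⇒≤ i<j)) =
  ∸-monoʳ-< i<j (m≤n⇒m≤o+n c j≤N)

reverseFrom-last : ∀ {N c} → c ≤ N → reverseFrom N c N ≡ c
reverseFrom-last {N} {c} c≤N = trans (reverseFrom-≥ N c≤N) (m+n∸n≡m c N)

reversalLetter : ∀ N → Fin (suc N) → Fin (suc N) → Fin (suc N)
reversalLetter N c i = fromℕ< (s≤s (reverseFrom-≤ {c = toℕ c} (toℕ≤pred[n] i)))

reversalWord : ∀ N → Fin (suc N) → Vec (Fin (suc N)) (suc N)
reversalWord N c = tabulate (reversalLetter N c)

toℕ-lookup-reversalWord : ∀ N c i → toℕ (lookup (reversalWord N c) i) ≡ reverseFrom N (toℕ c) (toℕ i)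
toℕ-lookup-reversalWord N c i = begin
  toℕ (lookup (reversalWord N c) i) ≡⟨ cong toℕ (lookup∘tabulate (reversalLetter N c) i) ⟩
  toℕ (reversalLetter N c i)        ≡⟨ toℕ-fromℕ< _ ⟩
  reverseFrom N (toℕ c) (toℕ i)     ∎
  where open ≡-Reasoning

reversalWord-isInvolution : ∀ N c → IsInvolution (reversalWord N c)
reversalWord-isInvolution N c i = toℕ-injective (begin
  toℕ (lookup w (lookup w i))                           ≡⟨ toℕ-lookup-reversalWord N c (lookup w i) ⟩
  reverseFrom N (toℕ c) (toℕ (lookup w i))              ≡⟨ cong (reverseFrom N (toℕ c)) (toℕ-lookup-reversalWord N c i) ⟩
  reverseFrom N (toℕ c) (reverseFrom N (toℕ c) (toℕ i)) ≡⟨ reverseFrom-involutive (toℕ c) (toℕ≤pred[n] i) ⟩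
  toℕ i                                                 ∎)
  where
  open ≡-Reasoning
  w = reversalWord N c

reversalWord-isUnimodal : ∀ N c → IsUnimodal (reversalWord N c)
reversalWord-isUnimodal N c = c , increasing , decreasing
  where
  value≡ = toℕ-lookup-reversalWord N c
  increasing = λ i j i<j j≤c → subst₂ _<_ (sym (value≡ i)) (sym (value≡ j))
    (reverseFrom-increasing i<j j≤c (toℕ≤pred[n] c))
  decreasing = λ i j c≤i i<j → subst₂ _<_ (sym (value≡ j)) (sym (value≡ i))
    (reverseFrom-decreasing c≤i i<j (toℕ≤pred[n] j))

reversalWord-last : ∀ N c → lookup (reversalWord N c) (fromℕ N) ≡ c
reversalWord-last N c = toℕ-injective (begin
  toℕ (lookup (reversalWord N c) (fromℕ N)) ≡⟨ toℕ-lookup-reversalWord N c (fromℕ N) ⟩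
  reverseFrom N (toℕ c) (toℕ (fromℕ N))     ≡⟨ cong (reverseFrom N (toℕ c)) (toℕ-fromℕ N) ⟩
  reverseFrom N (toℕ c) N                   ≡⟨ reverseFrom-last (toℕ≤pred[n] c) ⟩
  toℕ c                                     ∎)
  where open ≡-Reasoning

reversalWord-unimodalInvolution : ∀ N → Fin (suc N) → UnimodalInvolution (suc N)
reversalWord-unimodalInvolution N c =
  reversalWord N c , involution⇒perm (reversalWord N c) (reversalWord-isInvolution N c) ,
  reversalWord-isInvolution N c , reversalWord-isUnimodal N c

module Shape {N} (π : Vec (Fin (suc N)) (suc N)) (inv : IsInvolution π) (uni : IsUnimodal π) where

  value : Fin (suc N) → ℕ
  value i = toℕ (lookup π i)

  last : Fin (suc N)
  last = fromℕ N

  c : Fin (suc N)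
  c = lookup π last

  value-c : value c ≡ N
  value-c = trans (cong toℕ (inv last)) (toℕ-fromℕ N)

  peak≡c : proj₁ uni ≡ c
  peak≡c = involution⇒perm π inv (proj₁ uni) c (toℕ-injective value-peak≡value-c)
    where
    value-peak≡value-c : value (proj₁ uni) ≡ value c
    value-peak≡value-c = trans
      (≤-antisym (toℕ≤pred[n] (lookup π (proj₁ uni))) (subst (_≤ value (proj₁ uni)) value-c (peak-isMaximum π uni c)))
      (sym value-c)

  increasing : ∀ i j → toℕ i < toℕ j → toℕ j ≤ toℕ c → value i < value j
  increasing i j i<j j≤c = proj₁ (proj₂ uni) i j i<j (subst (λ m → toℕ j ≤ toℕ m) (sym peak≡c) j≤c)

  decreasing : ∀ i j → toℕ c ≤ toℕ i → toℕ i < toℕ j → value j < value i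
  decreasing i j c≤i i<j = proj₂ (proj₂ uni) i j (subst (λ m → toℕ m ≤ toℕ i) (sym peak≡c) c≤i) i<j

  c≤value : ∀ j → toℕ c ≤ toℕ j → toℕ c ≤ value j
  c≤value j c≤j with <-cmp (toℕ j) N
  ... | tri< j<N _ _ = <⇒≤ (decreasing j last c≤j (subst (toℕ j <_) (sym (toℕ-fromℕ N)) j<N))
  ... | tri≈ _ j≡N _ = ≤-reflexive (cong value (sym (toℕ-injective (trans j≡N (sym (toℕ-fromℕ N))))))
  ... | tri> _ _ N<j = ⊥-elim (<⇒≱ N<j (toℕ≤pred[n] j))

  value-value : ∀ i → value (lookup π i) ≡ toℕ i
  value-value i = cong toℕ (inv i)

  value-below : ∀ i → toℕ i < toℕ c → value i ≡ toℕ i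
  value-below i i<c with <-cmp (value i) (toℕ i)
  ... | tri≈ _ vi≡i _ = vi≡i
  ... | tri< vi<i _ _ =
    ⊥-elim (<-asym vi<i (subst (_< value i) (value-value i) (increasing (lookup π i) i vi<i (<⇒≤ i<c))))
  ... | tri> _ _ i<vi with value i ≤? toℕ c
  ...   | yes vi≤c = ⊥-elim (<-asym i<vi (subst (value i <_) (value-value i) (increasing i (lookup π i) i<vi vi≤c)))
  ...   | no  vi≰c = ⊥-elim (<⇒≱ i<c (subst (toℕ c ≤_) (value-value i) (c≤value (lookup π i) (<⇒≤ (≰⇒> vi≰c)))))

  value-above : ∀ i → toℕ c ≤ toℕ i → value i ≡ toℕ c + N ∸ toℕ i
  value-above i c≤i = trans (sym (extendℕ-toℕ value i))
    (decreasing-squeeze extended-decreasing extended-c≤N c≤extended-N c≤i (toℕ≤pred[n] i))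
    where
    q = extendℕ value
    extended-decreasing : StrictlyDecreasingOn (toℕ c) N q
    extended-decreasing k l c≤k k<l l≤N =
      subst₂ _<_ (sym (extendℕ-fromℕ< value l<1+N)) (sym (extendℕ-fromℕ< value k<1+N))
        (decreasing (fromℕ< k<1+N) (fromℕ< l<1+N)
          (subst (toℕ c ≤_) (sym (toℕ-fromℕ< k<1+N)) c≤k)
          (subst₂ _<_ (sym (toℕ-fromℕ< k<1+N)) (sym (toℕ-fromℕ< l<1+N)) k<l))
      where
      l<1+N : l < suc N
      l<1+N = s≤s l≤N
      k<1+N : k < suc N
      k<1+N = <-trans k<l l<1+N
    extended-c≤N : q (toℕ c) ≤ N
    extended-c≤N = subst (_≤ N) (sym (extendℕ-toℕ value c)) (toℕ≤pred[n] (lookup π c))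
    c≤extended-N : toℕ c ≤ q N
    c≤extended-N = ≤-reflexive (sym (trans (cong q (sym (toℕ-fromℕ N))) (extendℕ-toℕ value last)))

  value≡reverseFrom : ∀ i → value i ≡ reverseFrom N (toℕ c) (toℕ i)
  value≡reverseFrom i with toℕ i <? toℕ c
  ... | yes i<c = value-below i i<c
  ... | no  i≮c = value-above i (≮⇒≥ i≮c)

lastLetter : ∀ N → UnimodalInvolution (suc N) → Fin (suc N)
lastLetter N (π , _) = lookup π (fromℕ N)

lastLetter-determines : ∀ N (x y : UnimodalInvolution (suc N)) →
                        lastLetter N x ≡ lastLetter N y → proj₁ x ≡ proj₁ y
lastLetter-determines N (π , _ , invπ , uniπ) (σ , _ , invσ , uniσ) same-last = begin
  π                   ≡⟨ sym (tabulate∘lookup π) ⟩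
  tabulate (lookup π) ≡⟨ tabulate-cong (λ i → toℕ-injective (letters-agree i)) ⟩
  tabulate (lookup σ) ≡⟨ tabulate∘lookup σ ⟩
  σ                   ∎
  where
  open ≡-Reasoning
  module P = Shape π invπ uniπ
  module S = Shape σ invσ uniσ
  letters-agree : ∀ i → P.value i ≡ S.value i
  letters-agree i = trans (P.value≡reverseFrom i)
    (trans (cong (λ c → reverseFrom N (toℕ c) (toℕ i)) same-last) (sym (S.value≡reverseFrom i)))

lemma4p2 : ∀ (n : ℕ) → n ≥ 1 → CardinalityIs n n
lemma4p2 zero    ()
lemma4p2 (suc N) _ =
  lastLetter N ,
  lastLetter-determines N ,
  λ c → reversalWord-unimodalInvolution N c , reversalWord-last N c
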